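{- Let $u,v\in\{\mathtt{0},\mathtt{1}\}^*$ be such that $u$ is a prefix of $v$ or $v$ is a prefix of $u$. Then $\mu_q(\widetilde{u}\mathtt{0}\mathtt{1}v)_{12}\prec\mu_q(\widetilde{u}\mathtt{1}\mathtt{0}v)_{12}$.
   Context: $\widetilde{u}$ is the reversal of $u$ (letters in reverse order). $\mu_q$ is the monoid homomorphism $\{\mathtt{0},\mathtt{1}\}^*\to\mathrm{GL}_2(\mathbb{Z}[q^{\pm1}])$ with $\mu_q(\mathtt{0})=\begin{pmatrix} q+q^2 & 1\\ q & 1\end{pmatrix}$, $\mu_q(\mathtt{1})=\begin{pmatrix} q+2q^2+q^3+q^4 & 1+q\\ q+q^2 & 1\end{pmatrix}$; $M_{12}$ is the (1,2) entry. For $f,g\in\mathbb{Z}[q]$, $f\prec g$ means $f\ne g$ and $g-f\in\mathbb{Z}_{\ge0}[q]$. -}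

module Defs where

open import Data.Nat using (ℕ; zero; suc)
open import Data.Integer using (ℤ; +_; _+_; _*_; -_; _-_; _≤_)
open import Data.List using (List; []; _∷_; _++_; reverse)
open import Data.Product using (_×_; ∃; _,_)
open import Data.Sum using (_⊎_)
open import Relation.Binary.PropositionalEquality using (_≡_)
open import Relation.Nullary using (¬_)

data Letter : Set where
  𝟘 𝟙 : Letter

Word : Set
Word = List Letter

_IsPrefixOf_ : Word → Word → Set
u IsPrefixOf v = ∃ λ w → u ++ w ≡ v

-- Polynomials in ℤ[q] as coefficient lists (constant term first).
Poly : Set
Poly = List ℤ

coeff : Poly → ℕ → ℤ
coeff []       _       = + 0
coeff (a ∷ _)  zero    = a
coeff (_ ∷ p)  (suc n) = coeff p n

infixl 6 _⊕_
_⊕_ : Poly → Poly → Poly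
[] ⊕ q = q
(a ∷ p) ⊕ [] = a ∷ p
(a ∷ p) ⊕ (b ∷ q) = (a + b) ∷ (p ⊕ q)

scale : ℤ → Poly → Poly
scale c [] = []
scale c (a ∷ p) = c * a ∷ scale c p

infixl 7 _⊗_
_⊗_ : Poly → Poly → Poly
[] ⊗ q = []
(a ∷ p) ⊗ q = scale a q ⊕ (+ 0 ∷ (p ⊗ q))

record Mat : Set where
  constructor mat
  field
    m11 m12 m21 m22 : Poly
open Mat public

_·_ : Mat → Mat → Mat
mat a b c d · mat e f g h =
  mat (a ⊗ e ⊕ b ⊗ g) (a ⊗ f ⊕ b ⊗ h) (c ⊗ e ⊕ d ⊗ g) (c ⊗ f ⊕ d ⊗ h)

idMat : Mat
idMat = mat (+ 1 ∷ []) [] [] (+ 1 ∷ [])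

-- μ_q(0) = [[q+q², 1],[q, 1]],  μ_q(1) = [[q+2q²+q³+q⁴, 1+q],[q+q², 1]]
μLetter : Letter → Mat
μLetter 𝟘 = mat (+ 0 ∷ + 1 ∷ + 1 ∷ []) (+ 1 ∷ [])
                (+ 0 ∷ + 1 ∷ []) (+ 1 ∷ [])
μLetter 𝟙 = mat (+ 0 ∷ + 1 ∷ + 2 ∷ + 1 ∷ + 1 ∷ []) (+ 1 ∷ + 1 ∷ [])
                (+ 0 ∷ + 1 ∷ + 1 ∷ []) (+ 1 ∷ [])

μ : Word → Mat
μ []      = idMat
μ (x ∷ w) = μLetter x · μ w

_≺_ : Poly → Poly → Set
f ≺ g = ¬ (∀ n → coeff f n ≡ coeff g n) × (∀ n → coeff f n ≤ coeff g n)

-- Let J = [[0,1],[-q,0]]. Each letter satisfies μ(x) J μ(x) = q^d J with q^d = det μ(x), and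
-- μ(𝟙)μ(𝟘) = μ(𝟘)μ(𝟙) + (q + q⁴) J. Hence μ(ũ𝟙𝟘v) - μ(ũ𝟘𝟙v) = (q + q⁴) μ(ũ) J μ(v). If v = uw,
-- the middle μ(ũ) J μ(u) collapses to q^k J and the (1,2) entry of the difference becomes
-- (q + q⁴) q^k μ(w)₂₂; if u = vw, it becomes (q + q⁴) q^k μ(w̃)₁₁ in the same way. The diagonal
-- entries of every μ(t) have nonnegative coefficients and are nonzero, since the letter matrices
-- have nonnegative coefficients and the diagonal coefficients [q]μ(x)₁₁ and [1]μ(x)₂₂ are 1.

module Submission where

open import Defs
open import Algebra.Properties.CommutativeSemigroup using (interchange)
open import Data.Integer using (ℤ; +_; -[1+_]; 0ℤ; 1ℤ; -1ℤ; _+_; _*_; _≤_; _<_; +≤+; +<+)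
open import Data.Integer.Properties
open import Data.List using (List; []; _∷_; _++_; reverse; [_])
open import Data.List.Properties using (unfold-reverse; reverse-++)
open import Data.List.Relation.Unary.All using (All; []; _∷_; all?)
open import Data.Nat as ℕ using (ℕ; zero; suc; z≤n; s≤s)
open import Data.Nat.GeneralisedArithmetic using (fold; fold-+)
open import Data.Product using (_×_; _,_; proj₁; proj₂; ∃-syntax)
open import Data.Product.Relation.Binary.Pointwise.NonDependent using (_×ₛ_)
open import Data.Sum using (_⊎_; inj₁; inj₂)
open import Relation.Binary using (Setoid)
open import Relation.Binary.PropositionalEquality
  using (_≡_; _≗_; refl; sym; trans; cong; cong₂; subst; subst₂; _→-setoid_; module ≡-Reasoning)
import Relation.Binary.Reasoning.Setoid
open import Relation.Nullary using (¬_)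
open import Relation.Nullary.Decidable using (from-yes)

private
  +-interchange : ∀ a b c d → (a + b) + (c + d) ≡ (a + c) + (b + d)
  +-interchange = interchange +-commutativeSemigroup

Seq : Set
Seq = ℕ → ℤ

private
  variable
    f g : Seq

0ₛ : Seq
0ₛ _ = 0ℤ

δ₀ : Seq
δ₀ zero    = 1ℤ
δ₀ (suc n) = 0ℤ

infixl 6 _+ₛ_
_+ₛ_ : Seq → Seq → Seq
(f +ₛ g) n = f n + g n

shift : Seq → Seq
shift f zero    = 0ℤ
shift f (suc n) = f n

-- Polynomials act on coefficient sequences, shift being multiplication by q. Working with
-- these actions up to ≗ makes the trailing zeros of the list representation irrelevant.
infixr 7 _∙_
_∙_ : Poly → Seq → Seq
([] ∙ f) n      = 0ℤ
((a ∷ p) ∙ f) n = a * f n + shift (p ∙ f) n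

shift-cong : f ≗ g → shift f ≗ shift g
shift-cong f≗g zero    = refl
shift-cong f≗g (suc n) = f≗g n

shift-0ₛ : shift 0ₛ ≗ 0ₛ
shift-0ₛ zero    = refl
shift-0ₛ (suc n) = refl

shift-+ₛ : ∀ f g → shift (f +ₛ g) ≗ shift f +ₛ shift g
shift-+ₛ f g zero    = refl
shift-+ₛ f g (suc n) = refl

shift-* : ∀ a f → shift (λ n → a * f n) ≗ λ n → a * shift f n
shift-* a f zero    = sym (*-zeroʳ a)
shift-* a f (suc n) = refl

∙-cong : ∀ p → f ≗ g → p ∙ f ≗ p ∙ g
∙-cong []      f≗g n = refl
∙-cong (a ∷ p) f≗g n = cong₂ _+_ (cong (a *_) (f≗g n)) (shift-cong (∙-cong p f≗g) n)

∙-zeroʳ : ∀ p → p ∙ 0ₛ ≗ 0ₛ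
∙-zeroʳ []      n = refl
∙-zeroʳ (a ∷ p) n = cong₂ _+_ (*-zeroʳ a) (trans (shift-cong (∙-zeroʳ p) n) (shift-0ₛ n))

∙-identityˡ : ∀ f → (1ℤ ∷ []) ∙ f ≗ f
∙-identityˡ f n = trans (cong (_+_ (1ℤ * f n)) (shift-0ₛ n)) (trans (+-identityʳ _) (*-identityˡ _))

∙-δ₀ : ∀ p → p ∙ δ₀ ≗ coeff p
∙-δ₀ []      n       = refl
∙-δ₀ (a ∷ p) zero    = trans (+-identityʳ _) (*-identityʳ a)
∙-δ₀ (a ∷ p) (suc n) = trans (cong (_+ (p ∙ δ₀) n) (*-zeroʳ a)) (trans (+-identityˡ _) (∙-δ₀ p n))

∙-distribˡ : ∀ p f g → p ∙ (f +ₛ g) ≗ p ∙ f +ₛ p ∙ g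
∙-distribˡ []      f g n = refl
∙-distribˡ (a ∷ p) f g n = begin
  a * (f n + g n) + shift (p ∙ (f +ₛ g)) n
    ≡⟨ cong₂ _+_ (*-distribˡ-+ a (f n) (g n))
                 (trans (shift-cong (∙-distribˡ p f g) n) (shift-+ₛ (p ∙ f) (p ∙ g) n)) ⟩
  (a * f n + a * g n) + (shift (p ∙ f) n + shift (p ∙ g) n)
    ≡⟨ +-interchange (a * f n) (a * g n) _ _ ⟩
  (a * f n + shift (p ∙ f) n) + (a * g n + shift (p ∙ g) n) ∎
  where open ≡-Reasoning

∙-distribʳ : ∀ p q f → (p ⊕ q) ∙ f ≗ p ∙ f +ₛ q ∙ f
∙-distribʳ []      q       f n = sym (+-identityˡ _)
∙-distribʳ (a ∷ p) []      f n = sym (+-identityʳ _)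
∙-distribʳ (a ∷ p) (b ∷ q) f n = begin
  (a + b) * f n + shift ((p ⊕ q) ∙ f) n
    ≡⟨ cong₂ _+_ (*-distribʳ-+ (f n) a b)
                 (trans (shift-cong (∙-distribʳ p q f) n) (shift-+ₛ (p ∙ f) (q ∙ f) n)) ⟩
  (a * f n + b * f n) + (shift (p ∙ f) n + shift (q ∙ f) n)
    ≡⟨ +-interchange (a * f n) (b * f n) _ _ ⟩
  (a * f n + shift (p ∙ f) n) + (b * f n + shift (q ∙ f) n) ∎
  where open ≡-Reasoning

∙-scale : ∀ a p f → scale a p ∙ f ≗ λ n → a * (p ∙ f) n
∙-scale a []      f n = sym (*-zeroʳ a)
∙-scale a (b ∷ p) f n = begin
  a * b * f n + shift (scale a p ∙ f) n
    ≡⟨ cong₂ _+_ (*-assoc a b (f n)) (trans (shift-cong (∙-scale a p f) n) (shift-* a (p ∙ f) n)) ⟩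
  a * (b * f n) + a * shift (p ∙ f) n
    ≡⟨ *-distribˡ-+ a _ _ ⟨
  a * (b * f n + shift (p ∙ f) n) ∎
  where open ≡-Reasoning

0∷-∙ : ∀ p f → (0ℤ ∷ p) ∙ f ≗ shift (p ∙ f)
0∷-∙ p f n = +-identityˡ _

∙-assoc : ∀ c d f → c ∙ (d ∙ f) ≗ (c ⊗ d) ∙ f
∙-assoc []      d f n = refl
∙-assoc (a ∷ c) d f n = begin
  a * (d ∙ f) n + shift (c ∙ (d ∙ f)) n
    ≡⟨ cong₂ _+_ (∙-scale a d f n) (shift-cong (λ m → sym (∙-assoc c d f m)) n) ⟨
  (scale a d ∙ f) n + shift ((c ⊗ d) ∙ f) n
    ≡⟨ cong (_+_ ((scale a d ∙ f) n)) (0∷-∙ (c ⊗ d) f n) ⟨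
  (scale a d ∙ f) n + ((0ℤ ∷ c ⊗ d) ∙ f) n
    ≡⟨ ∙-distribʳ (scale a d) (0ℤ ∷ c ⊗ d) f n ⟨
  (((a ∷ c) ⊗ d) ∙ f) n ∎
  where open ≡-Reasoning

∙-shift : ∀ p f → p ∙ shift f ≗ shift (p ∙ f)
∙-shift []      f zero    = refl
∙-shift []      f (suc n) = refl
∙-shift (a ∷ p) f zero    = trans (+-identityʳ _) (*-zeroʳ a)
∙-shift (a ∷ p) f (suc n) = cong (_+_ (a * f n)) (∙-shift p f n)

-- Removing trailing zeros lets concrete matrix identities be checked by computation.
infixr 5 _∷ₜ_
_∷ₜ_ : ℤ → Poly → Poly
(+ zero) ∷ₜ [] = []
a        ∷ₜ p  = a ∷ p

trim : Poly → Poly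
trim []      = []
trim (a ∷ p) = a ∷ₜ trim p

∷ₜ-∙ : ∀ a p f → (a ∷ₜ p) ∙ f ≗ (a ∷ p) ∙ f
∷ₜ-∙ (+ zero)     []      f n = sym (trans (+-identityˡ _) (shift-0ₛ n))
∷ₜ-∙ (+ zero)     (b ∷ p) f n = refl
∷ₜ-∙ (+ suc m)    p       f n = refl
∷ₜ-∙ -[1+ m ]     p       f n = refl

trim-∙ : ∀ p f → trim p ∙ f ≗ p ∙ f
trim-∙ []      f n = refl
trim-∙ (a ∷ p) f n = trans (∷ₜ-∙ a (trim p) f n) (cong (_+_ (a * f n)) (shift-cong (trim-∙ p f) n))

Seq² : Set
Seq² = Seq × Seq

private
  variable
    z z′ : Seq²

Seq²-setoid : Setoid _ _
Seq²-setoid = (ℕ →-setoid ℤ) ×ₛ (ℕ →-setoid ℤ)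

open Setoid Seq²-setoid using ()
  renaming (_≈_ to _≋_; refl to ≋-refl; sym to ≋-sym; trans to ≋-trans)

module ≋-Reasoning = Relation.Binary.Reasoning.Setoid Seq²-setoid

e₁ e₂ : Seq²
e₁ = δ₀ , 0ₛ
e₂ = 0ₛ , δ₀

infixl 6 _+²_
_+²_ : Seq² → Seq² → Seq²
(x , y) +² (x′ , y′) = x +ₛ x′ , y +ₛ y′

shift² : Seq² → Seq²
shift² (x , y) = shift x , shift y

shiftⁿ : ℕ → Seq² → Seq²
shiftⁿ k z = fold z shift² k

+²-cong : ∀ {z₁ z₁′ z₂ z₂′} → z₁ ≋ z₁′ → z₂ ≋ z₂′ → z₁ +² z₂ ≋ z₁′ +² z₂′
+²-cong (x₁≗ , y₁≗) (x₂≗ , y₂≗) =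
  (λ n → cong₂ _+_ (x₁≗ n) (x₂≗ n)) , (λ n → cong₂ _+_ (y₁≗ n) (y₂≗ n))

shiftⁿ-cong : ∀ k → z ≋ z′ → shiftⁿ k z ≋ shiftⁿ k z′
shiftⁿ-cong zero    z≋z′ = z≋z′
shiftⁿ-cong (suc k) z≋z′ =
  shift-cong (proj₁ (shiftⁿ-cong k z≋z′)) , shift-cong (proj₂ (shiftⁿ-cong k z≋z′))

row : Poly → Poly → Seq² → Seq
row a b (x , y) = a ∙ x +ₛ b ∙ y

infixr 7 _▹_
_▹_ : Mat → Seq² → Seq²
M ▹ z = row (m11 M) (m12 M) z , row (m21 M) (m22 M) z

infixl 6 _⊕ᴹ_
_⊕ᴹ_ : Mat → Mat → Mat
M ⊕ᴹ N = mat (m11 M ⊕ m11 N) (m12 M ⊕ m12 N) (m21 M ⊕ m21 N) (m22 M ⊕ m22 N)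

mapᴹ : (Poly → Poly) → Mat → Mat
mapᴹ φ M = mat (φ (m11 M)) (φ (m12 M)) (φ (m21 M)) (φ (m22 M))

shiftᴹⁿ : ℕ → Mat → Mat
shiftᴹⁿ k M = fold M (mapᴹ (0ℤ ∷_)) k

row-cong : ∀ a b → z ≋ z′ → row a b z ≗ row a b z′
row-cong a b (x≗ , y≗) n = cong₂ _+_ (∙-cong a x≗ n) (∙-cong b y≗ n)

row-· : ∀ a b e f g h z →
        row (a ⊗ e ⊕ b ⊗ g) (a ⊗ f ⊕ b ⊗ h) z ≗ row a b (row e f z , row g h z)
row-· a b e f g h (x , y) n = begin
  ((a ⊗ e ⊕ b ⊗ g) ∙ x) n + ((a ⊗ f ⊕ b ⊗ h) ∙ y) n
    ≡⟨ cong₂ _+_ (∙-distribʳ (a ⊗ e) (b ⊗ g) x n) (∙-distribʳ (a ⊗ f) (b ⊗ h) y n) ⟩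
  ((a ⊗ e) ∙ x) n + ((b ⊗ g) ∙ x) n + (((a ⊗ f) ∙ y) n + ((b ⊗ h) ∙ y) n)
    ≡⟨ +-interchange (((a ⊗ e) ∙ x) n) _ _ _ ⟩
  ((a ⊗ e) ∙ x) n + ((a ⊗ f) ∙ y) n + (((b ⊗ g) ∙ x) n + ((b ⊗ h) ∙ y) n)
    ≡⟨ cong₂ _+_ (cong₂ _+_ (∙-assoc a e x n) (∙-assoc a f y n))
                 (cong₂ _+_ (∙-assoc b g x n) (∙-assoc b h y n)) ⟨
  (a ∙ e ∙ x) n + (a ∙ f ∙ y) n + ((b ∙ g ∙ x) n + (b ∙ h ∙ y) n)
    ≡⟨ cong₂ _+_ (∙-distribˡ a (e ∙ x) (f ∙ y) n) (∙-distribˡ b (g ∙ x) (h ∙ y) n) ⟨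
  (a ∙ (e ∙ x +ₛ f ∙ y)) n + (b ∙ (g ∙ x +ₛ h ∙ y)) n ∎
  where open ≡-Reasoning

row-⊕ : ∀ a b a′ b′ z → row (a ⊕ a′) (b ⊕ b′) z ≗ row a b z +ₛ row a′ b′ z
row-⊕ a b a′ b′ (x , y) n =
  trans (cong₂ _+_ (∙-distribʳ a a′ x n) (∙-distribʳ b b′ y n)) (+-interchange ((a ∙ x) n) _ _ _)

row-+² : ∀ a b z z′ → row a b (z +² z′) ≗ row a b z +ₛ row a b z′
row-+² a b (x , y) (x′ , y′) n =
  trans (cong₂ _+_ (∙-distribˡ a x x′ n) (∙-distribˡ b y y′ n)) (+-interchange ((a ∙ x) n) _ _ _)

row-shift² : ∀ a b z → row a b (shift² z) ≗ shift (row a b z)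
row-shift² a b (x , y) n =
  trans (cong₂ _+_ (∙-shift a x n) (∙-shift b y n)) (sym (shift-+ₛ (a ∙ x) (b ∙ y) n))

row-0∷ : ∀ a b z → row (0ℤ ∷ a) (0ℤ ∷ b) z ≗ shift (row a b z)
row-0∷ a b (x , y) n =
  trans (cong₂ _+_ (0∷-∙ a x n) (0∷-∙ b y n)) (sym (shift-+ₛ (a ∙ x) (b ∙ y) n))

row-trim : ∀ a b z → row (trim a) (trim b) z ≗ row a b z
row-trim a b (x , y) n = cong₂ _+_ (trim-∙ a x n) (trim-∙ b y n)

▹-cong : ∀ M → z ≋ z′ → M ▹ z ≋ M ▹ z′
▹-cong M z≋z′ = row-cong (m11 M) (m12 M) z≋z′ , row-cong (m21 M) (m22 M) z≋z′

▹-· : ∀ M N z → (M · N) ▹ z ≋ M ▹ N ▹ z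
▹-· M N z =
  row-· (m11 M) (m12 M) (m11 N) (m12 N) (m21 N) (m22 N) z ,
  row-· (m21 M) (m22 M) (m11 N) (m12 N) (m21 N) (m22 N) z

▹-⊕ᴹ : ∀ M N z → (M ⊕ᴹ N) ▹ z ≋ M ▹ z +² N ▹ z
▹-⊕ᴹ M N z =
  row-⊕ (m11 M) (m12 M) (m11 N) (m12 N) z , row-⊕ (m21 M) (m22 M) (m21 N) (m22 N) z

▹-+² : ∀ M z z′ → M ▹ (z +² z′) ≋ M ▹ z +² M ▹ z′
▹-+² M z z′ = row-+² (m11 M) (m12 M) z z′ , row-+² (m21 M) (m22 M) z z′

▹-shiftⁿ : ∀ M k z → M ▹ shiftⁿ k z ≋ shiftⁿ k (M ▹ z)
▹-shiftⁿ M zero    z = ≋-refl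
▹-shiftⁿ M (suc k) z = ≋-trans
  (row-shift² (m11 M) (m12 M) (shiftⁿ k z) , row-shift² (m21 M) (m22 M) (shiftⁿ k z))
  (shiftⁿ-cong 1 (▹-shiftⁿ M k z))

shiftᴹⁿ-▹ : ∀ k M z → shiftᴹⁿ k M ▹ z ≋ shiftⁿ k (M ▹ z)
shiftᴹⁿ-▹ zero    M z = ≋-refl
shiftᴹⁿ-▹ (suc k) M z = ≋-trans
  (row-0∷ (m11 M′) (m12 M′) z , row-0∷ (m21 M′) (m22 M′) z)
  (shiftⁿ-cong 1 (shiftᴹⁿ-▹ k M z))
  where M′ = shiftᴹⁿ k M

▹-trim : ∀ M N z → mapᴹ trim M ≡ mapᴹ trim N → M ▹ z ≋ N ▹ z
▹-trim M N z M≈N =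
  ≋-trans (≋-sym (trim-▹ M)) (subst (λ K → K ▹ z ≋ N ▹ z) (sym M≈N) (trim-▹ N))
  where
  trim-▹ : ∀ K → mapᴹ trim K ▹ z ≋ K ▹ z
  trim-▹ K = row-trim (m11 K) (m12 K) z , row-trim (m21 K) (m22 K) z

idMat-▹ : ∀ z → idMat ▹ z ≋ z
idMat-▹ (x , y) =
  (λ n → trans (+-identityʳ _) (∙-identityˡ x n)) , (λ n → trans (+-identityˡ _) (∙-identityˡ y n))

coeff-m12 : ∀ M → coeff (m12 M) ≗ proj₁ (M ▹ e₂)
coeff-m12 M n = sym (trans (cong₂ _+_ (∙-zeroʳ (m11 M) n) (∙-δ₀ (m12 M) n)) (+-identityˡ _))

μ-++ : ∀ t w z → μ (t ++ w) ▹ z ≋ μ t ▹ μ w ▹ z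
μ-++ []      w z = ≋-sym (idMat-▹ (μ w ▹ z))
μ-++ (x ∷ t) w z = begin
  (μLetter x · μ (t ++ w)) ▹ z   ≈⟨ ▹-· (μLetter x) (μ (t ++ w)) z ⟩
  μLetter x ▹ μ (t ++ w) ▹ z     ≈⟨ ▹-cong (μLetter x) (μ-++ t w z) ⟩
  μLetter x ▹ μ t ▹ μ w ▹ z      ≈⟨ ▹-· (μLetter x) (μ t) (μ w ▹ z) ⟨
  (μLetter x · μ t) ▹ μ w ▹ z    ∎
  where open ≋-Reasoning

μ-∷ : ∀ x t z → μ (x ∷ t) ▹ z ≋ μLetter x ▹ μ t ▹ z
μ-∷ x t = ▹-· (μLetter x) (μ t)

μ-++-∷-∷ : ∀ P x y v z → μ (P ++ x ∷ y ∷ v) ▹ z ≋ μ P ▹ μLetter x ▹ μLetter y ▹ μ v ▹ z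
μ-++-∷-∷ P x y v z = ≋-trans (μ-++ P (x ∷ y ∷ v) z)
  (▹-cong (μ P) (≋-trans (μ-∷ x (y ∷ v) z) (▹-cong (μLetter x) (μ-∷ y v z))))

J : Mat
J = mat [] (1ℤ ∷ []) (0ℤ ∷ -1ℤ ∷ []) []

detDegree : Letter → ℕ
detDegree 𝟘 = 2
detDegree 𝟙 = 4

-- Both letter matrices satisfy μ(x)₂₁ = q μ(x)₁₂, which makes μ(x) J μ(x) = det μ(x) J.
μLetter-J-μLetter : ∀ x →
  mapᴹ trim (μLetter x · (J · μLetter x)) ≡ mapᴹ trim (shiftᴹⁿ (detDegree x) J)
μLetter-J-μLetter 𝟘 = refl
μLetter-J-μLetter 𝟙 = refl

letter-commutator :
  mapᴹ trim (μLetter 𝟙 · μLetter 𝟘) ≡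
  mapᴹ trim (μLetter 𝟘 · μLetter 𝟙 ⊕ᴹ (shiftᴹⁿ 1 J ⊕ᴹ shiftᴹⁿ 4 J))
letter-commutator = refl

μLetter-J-μLetter-▹ : ∀ x z → μLetter x ▹ J ▹ μLetter x ▹ z ≋ shiftⁿ (detDegree x) (J ▹ z)
μLetter-J-μLetter-▹ x z = begin
  X ▹ J ▹ X ▹ z          ≈⟨ ▹-cong X (▹-· J X z) ⟨
  X ▹ (J · X) ▹ z        ≈⟨ ▹-· X (J · X) z ⟨
  (X · (J · X)) ▹ z      ≈⟨ ▹-trim (X · (J · X)) (shiftᴹⁿ d J) z (μLetter-J-μLetter x) ⟩
  shiftᴹⁿ d J ▹ z        ≈⟨ shiftᴹⁿ-▹ d J z ⟩
  shiftⁿ d (J ▹ z)       ∎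
  where
  open ≋-Reasoning
  X = μLetter x
  d = detDegree x

detDegreeʷ : Word → ℕ
detDegreeʷ []      = 0
detDegreeʷ (x ∷ u) = detDegree x ℕ.+ detDegreeʷ u

μ-reverse-J-μ-▹ : ∀ u z → μ (reverse u) ▹ J ▹ μ u ▹ z ≋ shiftⁿ (detDegreeʷ u) (J ▹ z)
μ-reverse-J-μ-▹ []      z = ≋-trans (idMat-▹ (J ▹ idMat ▹ z)) (▹-cong J (idMat-▹ z))
μ-reverse-J-μ-▹ (x ∷ u) z = begin
  μ (reverse (x ∷ u)) ▹ J ▹ μ (x ∷ u) ▹ z
    ≡⟨ cong (λ t → μ t ▹ J ▹ μ (x ∷ u) ▹ z) (unfold-reverse x u) ⟩
  μ (reverse u ++ [ x ]) ▹ J ▹ μ (x ∷ u) ▹ z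
    ≈⟨ μ-++ (reverse u) [ x ] _ ⟩
  μ (reverse u) ▹ μ [ x ] ▹ J ▹ μ (x ∷ u) ▹ z
    ≈⟨ ▹-cong (μ (reverse u)) (≋-trans (μ-∷ x [] _) (▹-cong X (idMat-▹ _))) ⟩
  μ (reverse u) ▹ X ▹ J ▹ μ (x ∷ u) ▹ z
    ≈⟨ ▹-cong (μ (reverse u)) (▹-cong X (▹-cong J (μ-∷ x u z))) ⟩
  μ (reverse u) ▹ X ▹ J ▹ X ▹ μ u ▹ z
    ≈⟨ ▹-cong (μ (reverse u)) (μLetter-J-μLetter-▹ x (μ u ▹ z)) ⟩
  μ (reverse u) ▹ shiftⁿ d (J ▹ μ u ▹ z)
    ≈⟨ ▹-shiftⁿ (μ (reverse u)) d (J ▹ μ u ▹ z) ⟩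
  shiftⁿ d (μ (reverse u) ▹ J ▹ μ u ▹ z)
    ≈⟨ shiftⁿ-cong d (μ-reverse-J-μ-▹ u z) ⟩
  shiftⁿ d (shiftⁿ (detDegreeʷ u) (J ▹ z))
    ≡⟨ fold-+ (J ▹ z) shift² d ⟨
  shiftⁿ (detDegreeʷ (x ∷ u)) (J ▹ z) ∎
  where
  open ≋-Reasoning
  X = μLetter x
  d = detDegree x

letter-commutator-▹ : ∀ z → μLetter 𝟙 ▹ μLetter 𝟘 ▹ z ≋
                      μLetter 𝟘 ▹ μLetter 𝟙 ▹ z +² (shiftⁿ 1 (J ▹ z) +² shiftⁿ 4 (J ▹ z))
letter-commutator-▹ z = begin
  B ▹ A ▹ z
    ≈⟨ ▹-· B A z ⟨
  (B · A) ▹ z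
    ≈⟨ ▹-trim (B · A) (A · B ⊕ᴹ qJ) z letter-commutator ⟩
  (A · B ⊕ᴹ qJ) ▹ z
    ≈⟨ ▹-⊕ᴹ (A · B) qJ z ⟩
  (A · B) ▹ z +² qJ ▹ z
    ≈⟨ +²-cong (▹-· A B z) (▹-⊕ᴹ (shiftᴹⁿ 1 J) (shiftᴹⁿ 4 J) z) ⟩
  A ▹ B ▹ z +² (shiftᴹⁿ 1 J ▹ z +² shiftᴹⁿ 4 J ▹ z)
    ≈⟨ +²-cong (≋-refl {A ▹ B ▹ z}) (+²-cong (shiftᴹⁿ-▹ 1 J z) (shiftᴹⁿ-▹ 4 J z)) ⟩
  A ▹ B ▹ z +² (shiftⁿ 1 (J ▹ z) +² shiftⁿ 4 (J ▹ z)) ∎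
  where
  open ≋-Reasoning
  A = μLetter 𝟘
  B = μLetter 𝟙
  qJ = shiftᴹⁿ 1 J ⊕ᴹ shiftᴹⁿ 4 J

swap-middle-▹ : ∀ P v → let W = μ P ▹ J ▹ μ v ▹ e₂ in
                μ (P ++ 𝟙 ∷ 𝟘 ∷ v) ▹ e₂ ≋ μ (P ++ 𝟘 ∷ 𝟙 ∷ v) ▹ e₂ +² (shiftⁿ 1 W +² shiftⁿ 4 W)
swap-middle-▹ P v = begin
  μ (P ++ 𝟙 ∷ 𝟘 ∷ v) ▹ e₂
    ≈⟨ μ-++-∷-∷ P 𝟙 𝟘 v e₂ ⟩
  M ▹ B ▹ A ▹ c
    ≈⟨ ▹-cong M (letter-commutator-▹ c) ⟩
  M ▹ (A ▹ B ▹ c +² (shiftⁿ 1 (J ▹ c) +² shiftⁿ 4 (J ▹ c)))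
    ≈⟨ ≋-trans (▹-+² M _ _) (+²-cong (≋-refl {M ▹ A ▹ B ▹ c}) (▹-+² M _ _)) ⟩
  M ▹ A ▹ B ▹ c +² (M ▹ shiftⁿ 1 (J ▹ c) +² M ▹ shiftⁿ 4 (J ▹ c))
    ≈⟨ +²-cong (≋-sym (μ-++-∷-∷ P 𝟘 𝟙 v e₂))
               (+²-cong (▹-shiftⁿ M 1 (J ▹ c)) (▹-shiftⁿ M 4 (J ▹ c))) ⟩
  μ (P ++ 𝟘 ∷ 𝟙 ∷ v) ▹ e₂ +² (shiftⁿ 1 (M ▹ J ▹ c) +² shiftⁿ 4 (M ▹ J ▹ c)) ∎
  where
  open ≋-Reasoning
  A = μLetter 𝟘
  B = μLetter 𝟙
  M = μ P
  c = μ v ▹ e₂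

m12-swap-middle : ∀ P v → let W = μ P ▹ J ▹ μ v ▹ e₂ in
                  coeff (m12 (μ (P ++ 𝟙 ∷ 𝟘 ∷ v))) ≗
                  coeff (m12 (μ (P ++ 𝟘 ∷ 𝟙 ∷ v))) +ₛ proj₁ (shiftⁿ 1 W +² shiftⁿ 4 W)
m12-swap-middle P v n = trans (coeff-m12 (μ (P ++ 𝟙 ∷ 𝟘 ∷ v)) n)
  (trans (proj₁ (swap-middle-▹ P v) n)
         (cong (_+ correction n) (sym (coeff-m12 (μ (P ++ 𝟘 ∷ 𝟙 ∷ v)) n))))
  where
  W = μ P ▹ J ▹ μ v ▹ e₂
  correction = proj₁ (shiftⁿ 1 W +² shiftⁿ 4 W)

NonNeg : Seq → Set
NonNeg f = ∀ n → 0ℤ ≤ f n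

Nontrivial : Seq → Set
Nontrivial f = ∃[ n ] 0ℤ < f n

Positive : Seq → Set
Positive f = NonNeg f × Nontrivial f

NonNeg² : Seq² → Set
NonNeg² (x , y) = NonNeg x × NonNeg y

entries : Mat → List Poly
entries M = m11 M ∷ m12 M ∷ m21 M ∷ m22 M ∷ []

NonNegᴹ : Mat → Set
NonNegᴹ M = All (All (0ℤ ≤_)) (entries M)

0≤* : ∀ {a b} → 0ℤ ≤ a → 0ℤ ≤ b → 0ℤ ≤ a * b
0≤* {+ m} {+ k} (+≤+ z≤n) (+≤+ z≤n) = subst (0ℤ ≤_) (pos-* m k) (+≤+ z≤n)

0<* : ∀ {a b} → 0ℤ < a → 0ℤ < b → 0ℤ < a * b
0<* (+<+ (s≤s z≤n)) (+<+ (s≤s z≤n)) = +<+ (s≤s z≤n)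

NonNeg-≗ : f ≗ g → NonNeg f → NonNeg g
NonNeg-≗ f≗g f≥0 n = subst (0ℤ ≤_) (f≗g n) (f≥0 n)

Nontrivial-≗ : f ≗ g → Nontrivial f → Nontrivial g
Nontrivial-≗ f≗g (n , fn>0) = n , subst (0ℤ <_) (f≗g n) fn>0

Positive-≗ : f ≗ g → Positive f → Positive g
Positive-≗ f≗g (f≥0 , f≠0) = NonNeg-≗ f≗g f≥0 , Nontrivial-≗ f≗g f≠0

NonNeg²-≋ : z ≋ z′ → NonNeg² z → NonNeg² z′
NonNeg²-≋ (x≗ , y≗) (x≥0 , y≥0) = NonNeg-≗ x≗ x≥0 , NonNeg-≗ y≗ y≥0

shift-nonNeg : NonNeg f → NonNeg (shift f)
shift-nonNeg f≥0 zero    = +≤+ z≤n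
shift-nonNeg f≥0 (suc n) = f≥0 n

shiftⁿ-positive₁ : ∀ k z → Positive (proj₁ z) → Positive (proj₁ (shiftⁿ k z))
shiftⁿ-positive₁ zero    z z₁>0 = z₁>0
shiftⁿ-positive₁ (suc k) z z₁>0 with shiftⁿ-positive₁ k z z₁>0
... | w≥0 , (n , wn>0) = shift-nonNeg w≥0 , (suc n , wn>0)

+ₛ-nonNeg : NonNeg f → NonNeg g → NonNeg (f +ₛ g)
+ₛ-nonNeg f≥0 g≥0 n = +-mono-≤ (f≥0 n) (g≥0 n)

+ₛ-nontrivialˡ : Nontrivial f → NonNeg g → Nontrivial (f +ₛ g)
+ₛ-nontrivialˡ (n , fn>0) g≥0 = n , +-mono-<-≤ fn>0 (g≥0 n)

+ₛ-nontrivialʳ : NonNeg f → Nontrivial g → Nontrivial (f +ₛ g)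
+ₛ-nontrivialʳ f≥0 (n , gn>0) = n , +-mono-≤-< (f≥0 n) gn>0

+ₛ-positive : Positive f → Positive g → Positive (f +ₛ g)
+ₛ-positive (f≥0 , f≠0) (g≥0 , _) = +ₛ-nonNeg f≥0 g≥0 , +ₛ-nontrivialˡ f≠0 g≥0

∙-nonNeg : ∀ {p} → All (0ℤ ≤_) p → NonNeg f → NonNeg (p ∙ f)
∙-nonNeg []          f≥0 n = +≤+ z≤n
∙-nonNeg (a≥0 ∷ p≥0) f≥0 n = +-mono-≤ (0≤* a≥0 (f≥0 n)) (shift-nonNeg (∙-nonNeg p≥0 f≥0) n)

∙-positive : ∀ {p} i j → All (0ℤ ≤_) p → NonNeg f →
             0ℤ < coeff p i → 0ℤ < f j → 0ℤ < (p ∙ f) (i ℕ.+ j)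
∙-positive {p = []} i j _ _ (+<+ ()) fj>0
∙-positive zero    j (a≥0 ∷ p≥0) f≥0 a>0 fj>0 =
  +-mono-<-≤ (0<* a>0 fj>0) (shift-nonNeg (∙-nonNeg p≥0 f≥0) j)
∙-positive (suc i) j (a≥0 ∷ p≥0) f≥0 pi>0 fj>0 =
  +-mono-≤-< (0≤* a≥0 (f≥0 _)) (∙-positive i j p≥0 f≥0 pi>0 fj>0)

∙-nontrivial : ∀ {p} i → All (0ℤ ≤_) p → NonNeg f →
               0ℤ < coeff p i → Nontrivial f → Nontrivial (p ∙ f)
∙-nontrivial i p≥0 f≥0 pi>0 (j , fj>0) = i ℕ.+ j , ∙-positive i j p≥0 f≥0 pi>0 fj>0

▹-nonNeg : ∀ {M} → NonNegᴹ M → NonNeg² z → NonNeg² (M ▹ z)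
▹-nonNeg (a≥0 ∷ b≥0 ∷ c≥0 ∷ d≥0 ∷ []) (x≥0 , y≥0) =
  +ₛ-nonNeg (∙-nonNeg a≥0 x≥0) (∙-nonNeg b≥0 y≥0) ,
  +ₛ-nonNeg (∙-nonNeg c≥0 x≥0) (∙-nonNeg d≥0 y≥0)

▹-nontrivial₁ : ∀ {M} i → NonNegᴹ M → 0ℤ < coeff (m11 M) i →
                NonNeg² z → Nontrivial (proj₁ z) → Nontrivial (proj₁ (M ▹ z))
▹-nontrivial₁ i (a≥0 ∷ b≥0 ∷ _) ai>0 (x≥0 , y≥0) x≠0 =
  +ₛ-nontrivialˡ (∙-nontrivial i a≥0 x≥0 ai>0 x≠0) (∙-nonNeg b≥0 y≥0)

▹-nontrivial₂ : ∀ {M} i → NonNegᴹ M → 0ℤ < coeff (m22 M) i →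
                NonNeg² z → Nontrivial (proj₂ z) → Nontrivial (proj₂ (M ▹ z))
▹-nontrivial₂ i (_ ∷ _ ∷ c≥0 ∷ d≥0 ∷ []) di>0 (x≥0 , y≥0) y≠0 =
  +ₛ-nontrivialʳ (∙-nonNeg c≥0 x≥0) (∙-nontrivial i d≥0 y≥0 di>0 y≠0)

record PositivityPreserving (M : Mat) : Set where
  field
    nonNeg      : ∀ {z} → NonNeg² z → NonNeg² (M ▹ z)
    nontrivial₁ : ∀ {z} → NonNeg² z → Nontrivial (proj₁ z) → Nontrivial (proj₁ (M ▹ z))
    nontrivial₂ : ∀ {z} → NonNeg² z → Nontrivial (proj₂ z) → Nontrivial (proj₂ (M ▹ z))

open PositivityPreserving

μLetter-nonNeg : ∀ x → NonNegᴹ (μLetter x)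
μLetter-nonNeg 𝟘 = from-yes (all? (all? (0ℤ ≤?_)) (entries (μLetter 𝟘)))
μLetter-nonNeg 𝟙 = from-yes (all? (all? (0ℤ ≤?_)) (entries (μLetter 𝟙)))

μLetter-diagonal : ∀ x → 0ℤ < coeff (m11 (μLetter x)) 1 × 0ℤ < coeff (m22 (μLetter x)) 0
μLetter-diagonal 𝟘 = +<+ (s≤s z≤n) , +<+ (s≤s z≤n)
μLetter-diagonal 𝟙 = +<+ (s≤s z≤n) , +<+ (s≤s z≤n)

letter-positivityPreserving : ∀ x → PositivityPreserving (μLetter x)
letter-positivityPreserving x = record
  { nonNeg      = ▹-nonNeg (μLetter-nonNeg x)
  ; nontrivial₁ = ▹-nontrivial₁ 1 (μLetter-nonNeg x) (proj₁ (μLetter-diagonal x))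
  ; nontrivial₂ = ▹-nontrivial₂ 0 (μLetter-nonNeg x) (proj₂ (μLetter-diagonal x))
  }

·-positivityPreserving : ∀ {M N} → PositivityPreserving M → PositivityPreserving N →
                         PositivityPreserving (M · N)
·-positivityPreserving {M} {N} M⁺ N⁺ = record
  { nonNeg      = λ {z} z≥0 → NonNeg²-≋ (≋-sym (▹-· M N z)) (nonNeg M⁺ (nonNeg N⁺ z≥0))
  ; nontrivial₁ = λ {z} z≥0 z₁≠0 → Nontrivial-≗ (proj₁ (≋-sym (▹-· M N z)))
                    (nontrivial₁ M⁺ (nonNeg N⁺ z≥0) (nontrivial₁ N⁺ z≥0 z₁≠0))
  ; nontrivial₂ = λ {z} z≥0 z₂≠0 → Nontrivial-≗ (proj₂ (≋-sym (▹-· M N z)))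
                    (nontrivial₂ M⁺ (nonNeg N⁺ z≥0) (nontrivial₂ N⁺ z≥0 z₂≠0))
  }

idMat-positivityPreserving : PositivityPreserving idMat
idMat-positivityPreserving = record
  { nonNeg      = λ {z} → NonNeg²-≋ (≋-sym (idMat-▹ z))
  ; nontrivial₁ = λ {z} _ → Nontrivial-≗ (proj₁ (≋-sym (idMat-▹ z)))
  ; nontrivial₂ = λ {z} _ → Nontrivial-≗ (proj₂ (≋-sym (idMat-▹ z)))
  }

μ-positivityPreserving : ∀ t → PositivityPreserving (μ t)
μ-positivityPreserving []      = idMat-positivityPreserving
μ-positivityPreserving (x ∷ t) =
  ·-positivityPreserving (letter-positivityPreserving x) (μ-positivityPreserving t)

0ₛ-nonNeg : NonNeg 0ₛ
0ₛ-nonNeg n = +≤+ z≤n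

δ₀-positive : Positive δ₀
δ₀-positive = (λ { zero → +≤+ z≤n ; (suc n) → +≤+ z≤n }) , (0 , +<+ (s≤s z≤n))

e₁-nonNeg : NonNeg² e₁
e₁-nonNeg = proj₁ δ₀-positive , 0ₛ-nonNeg

e₂-nonNeg : NonNeg² e₂
e₂-nonNeg = 0ₛ-nonNeg , proj₁ δ₀-positive

J-▹₁ : ∀ z → proj₁ (J ▹ z) ≗ proj₂ z
J-▹₁ (x , y) n = trans (+-identityˡ _) (∙-identityˡ y n)

J-▹-e₂ : J ▹ e₂ ≋ e₁
J-▹-e₂ = J-▹₁ e₂ , λ n → trans (+-identityʳ _) (∙-zeroʳ (0ℤ ∷ -1ℤ ∷ []) n)

prefix-sandwich-positive : ∀ u v → u IsPrefixOf v ⊎ v IsPrefixOf u →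
                           Positive (proj₁ (μ (reverse u) ▹ J ▹ μ v ▹ e₂))
prefix-sandwich-positive u .(u ++ w) (inj₁ (w , refl)) =
  Positive-≗ (λ n → sym (proj₁ W≋ n))
    (shiftⁿ-positive₁ (detDegreeʷ u) (J ▹ c) (Positive-≗ (λ n → sym (J-▹₁ c n)) c₂-positive))
  where
  c = μ w ▹ e₂
  W≋ : μ (reverse u) ▹ J ▹ μ (u ++ w) ▹ e₂ ≋ shiftⁿ (detDegreeʷ u) (J ▹ c)
  W≋ = ≋-trans (▹-cong (μ (reverse u)) (▹-cong J (μ-++ u w e₂))) (μ-reverse-J-μ-▹ u c)
  c₂-positive : Positive (proj₂ c)
  c₂-positive = proj₂ (nonNeg (μ-positivityPreserving w) e₂-nonNeg) ,
                nontrivial₂ (μ-positivityPreserving w) e₂-nonNeg (proj₂ δ₀-positive)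
prefix-sandwich-positive .(v ++ w) v (inj₂ (w , refl)) =
  Positive-≗ (λ n → sym (proj₁ W≋ n)) (shiftⁿ-positive₁ (detDegreeʷ v) c c₁-positive)
  where
  c = μ (reverse w) ▹ e₁
  W≋ : μ (reverse (v ++ w)) ▹ J ▹ μ v ▹ e₂ ≋ shiftⁿ (detDegreeʷ v) c
  W≋ = begin
    μ (reverse (v ++ w)) ▹ J ▹ μ v ▹ e₂
      ≡⟨ cong (λ t → μ t ▹ J ▹ μ v ▹ e₂) (reverse-++ v w) ⟩
    μ (reverse w ++ reverse v) ▹ J ▹ μ v ▹ e₂
      ≈⟨ μ-++ (reverse w) (reverse v) _ ⟩
    μ (reverse w) ▹ μ (reverse v) ▹ J ▹ μ v ▹ e₂
      ≈⟨ ▹-cong (μ (reverse w))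
                (≋-trans (μ-reverse-J-μ-▹ v e₂) (shiftⁿ-cong (detDegreeʷ v) J-▹-e₂)) ⟩
    μ (reverse w) ▹ shiftⁿ (detDegreeʷ v) e₁
      ≈⟨ ▹-shiftⁿ (μ (reverse w)) (detDegreeʷ v) e₁ ⟩
    shiftⁿ (detDegreeʷ v) c ∎
    where open ≋-Reasoning
  c₁-positive : Positive (proj₁ c)
  c₁-positive = proj₁ (nonNeg (μ-positivityPreserving (reverse w)) e₁-nonNeg) ,
                nontrivial₁ (μ-positivityPreserving (reverse w)) e₁-nonNeg (proj₂ δ₀-positive)

≺-intro : ∀ p q d → coeff q ≗ coeff p +ₛ d → Positive d → p ≺ q
≺-intro p q d q≗p+d (d≥0 , (k , dk>0)) = p≉q , p≤q
  where
  p≤q : ∀ n → coeff p n ≤ coeff q n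
  p≤q n = subst₂ _≤_ (+-identityʳ _) (sym (q≗p+d n)) (+-monoʳ-≤ (coeff p n) (d≥0 n))
  p≉q : ¬ (∀ n → coeff p n ≡ coeff q n)
  p≉q p≈q = <-irrefl (p≈q k)
    (subst₂ _<_ (+-identityʳ _) (sym (q≗p+d k)) (+-monoʳ-< (coeff p k) dk>0))

proposition3p2 : (u v : Word) → u IsPrefixOf v ⊎ v IsPrefixOf u →
    m12 (μ (reverse u ++ 𝟘 ∷ 𝟙 ∷ v)) ≺ m12 (μ (reverse u ++ 𝟙 ∷ 𝟘 ∷ v))
proposition3p2 u v prefix =
  ≺-intro (m12 (μ (reverse u ++ 𝟘 ∷ 𝟙 ∷ v))) (m12 (μ (reverse u ++ 𝟙 ∷ 𝟘 ∷ v))) _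
    (m12-swap-middle (reverse u) v)
    (+ₛ-positive (shiftⁿ-positive₁ 1 W W>0) (shiftⁿ-positive₁ 4 W W>0))
  where
  W = μ (reverse u) ▹ J ▹ μ v ▹ e₂
  W>0 = prefix-sandwich-positive u v prefix
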